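{- For any connected graph $G$ of order $n$ and diameter $d$, $pd_s(G)\le n-d+1$.
   Context: Graphs are finite, simple, connected; $d_G$ is shortest-path distance, $d_G(x,W)=\min\{d_G(x,w):w\in W\}$. A set $W$ strongly resolves different vertices $x,y\notin W$ if $d_G(x,W)=d_G(x,y)+d_G(y,W)$ or $d_G(y,W)=d_G(y,x)+d_G(x,W)$. A vertex partition $\Pi$ is a strong resolving partition if every two different vertices in the same set of $\Pi$ are strongly resolved by some set of $\Pi$; the strong partition dimension $pd_s(G)$ is the minimum cardinality of such a partition. -}

module Defs where

open import Data.Nat using (ℕ; zero; suc; _+_; _≤_)
open import Data.Fin using (Fin)
open import Data.Product using (Σ; ∃; ∃-syntax; _×_; _,_)
open import Data.Sum using (_⊎_)
open import Relation.Nullary using (¬_)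
open import Relation.Binary.PropositionalEquality using (_≡_; _≢_)
open import Relation.Binary using (Decidable)

record SimpleGraph (n : ℕ) : Set₁ where
  field
    Adj     : Fin n → Fin n → Set
    adj?    : Decidable Adj
    sym     : ∀ {x y} → Adj x y → Adj y x
    irrefl  : ∀ {x} → ¬ Adj x x
open SimpleGraph public

module _ {n : ℕ} (G : SimpleGraph n) where

  data Walk : Fin n → Fin n → ℕ → Set where
    here : ∀ {x} → Walk x x zero
    step : ∀ {x y z k} → Adj G x y → Walk y z k → Walk x z (suc k)

  Connected : Set
  Connected = ∀ x y → ∃[ k ] Walk x y k

  Dist : Fin n → Fin n → ℕ → Set
  Dist x y k = Walk x y k × (∀ m → Walk x y m → k ≤ m)

  Diameter : ℕ → Set
  Diameter d = (∃[ x ] ∃[ y ] Dist x y d)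
             × (∀ x y k → Dist x y k → k ≤ d)

  DistSet : Fin n → (Fin n → Set) → ℕ → Set
  DistSet x W k = (∃[ w ] (W w × Dist x w k))
                × (∀ w → W w → ∀ m → Dist x w m → k ≤ m)

  StronglyResolves : (Fin n → Set) → Fin n → Fin n → Set
  StronglyResolves W x y =
      (∃[ a ] ∃[ b ] ∃[ c ] (DistSet x W a × Dist x y b × DistSet y W c × a ≡ b + c))
    ⊎ (∃[ a ] ∃[ b ] ∃[ c ] (DistSet y W a × Dist y x b × DistSet x W c × a ≡ b + c))

  Part : ∀ {k} → (Fin n → Fin k) → Fin k → Fin n → Set
  Part Π j v = Π v ≡ j

  IsStrongResolvingPartition : (k : ℕ) → (Fin n → Fin k) → Set
  IsStrongResolvingPartition k Π =
      (∀ j → ∃[ v ] Π v ≡ j)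
    × (∀ x y → x ≢ y → Π x ≡ Π y →
         ∃[ j ] (Π x ≢ j × StronglyResolves (Part Π j) x y))

  -- pd_s(G) ≤ b  (pd_s is the minimum size of a strong resolving partition)
  StrongPartitionDimension≤ : ℕ → Set
  StrongPartitionDimension≤ b =
    ∃[ k ] (k ≤ b × Σ (Fin n → Fin k) (IsStrongResolvingPartition k))

-- Choose a shortest path x = v₀, v₁, …, v_d = y realising the
-- diameter.  Put v₀, …, v_{d-1} into one class and every other vertex into
-- a singleton class; this gives n - d + 1 classes.  Two distinct vertices of
-- the same class are v_i, v_j with i < j < d, and the class {y} strongly
-- resolves them: along a geodesic distances add up, so
--     d(v_i, y) = d(v_i, v_j) + d(v_j, y).
module Submission where

open import Defs hiding (sym)
open import Data.Nat using (ℕ; zero; suc; _+_; _∸_; _≤_; _<_; z≤n; s≤s)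
open import Data.Nat.Properties
  using (≤-refl; ≤-trans; ≤-reflexive; <-irrefl; <-cmp; <⇒≤; +-comm; +-∸-assoc; m∸n+n≡m; m+[n∸m]≡n; m≤m+n; m≤n+o⇒m∸n≤o; m<n⇒0<n∸m; +-cancelʳ-≤; ∸-monoˡ-≤; pred-mono-≤; pred[m∸n]≡m∸[1+n])
open import Data.Fin using (Fin; zero; suc; punchOut; punchIn; toℕ) renaming (_≟_ to _≟F_)
open import Data.Fin.Properties
  using (¬Fin0; suc-injective; punchOut-injective; punchOut-cong; punchOut-punchIn; punchInᵢ≢i; toℕ-injective; toℕ<n)
open import Data.Product using (Σ; ∃-syntax; _×_; _,_; proj₁; proj₂)
open import Data.Sum using (_⊎_; inj₁; inj₂)
open import Data.Empty using (⊥-elim)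
open import Relation.Nullary using (yes; no)
open import Relation.Binary using (tri<; tri≈; tri>)
open import Relation.Binary.PropositionalEquality
open import Function using (_∘_)
open import Function.Definitions using (Injective)

-- Merging two distinct classes a, b of a partition into Fin (suc k):
-- class a is sent to wherever b goes, the rest are renumbered into Fin k.
merge : ∀ {k} (a b : Fin (suc k)) → a ≢ b → Fin (suc k) → Fin k
merge a b a≢b c with c ≟F a
... | yes _ = punchOut a≢b
... | no c≢a = punchOut (c≢a ∘ sym)

merge-other : ∀ {k} (a b : Fin (suc k)) (a≢b : a ≢ b) c (c≢a : c ≢ a) →
              merge a b a≢b c ≡ punchOut (c≢a ∘ sym)
merge-other a b a≢b c c≢a with c ≟F a
... | yes c≡a = ⊥-elim (c≢a c≡a)
... | no _ = punchOut-cong a refl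

merge-surjective : ∀ {k} (a b : Fin (suc k)) (a≢b : a ≢ b) t → ∃[ c ] merge a b a≢b c ≡ t
merge-surjective a b a≢b t =
  punchIn a t , trans (merge-other a b a≢b (punchIn a t) (punchInᵢ≢i a t)) (punchOut-punchIn a)

data Merged {k} (a b c c′ : Fin (suc k)) : Set where
  same : c ≡ c′ → Merged a b c c′
  ab   : c ≡ a → c′ ≡ b → Merged a b c c′
  ba   : c ≡ b → c′ ≡ a → Merged a b c c′

merge-identifies : ∀ {k} (a b : Fin (suc k)) (a≢b : a ≢ b) c c′ →
                   merge a b a≢b c ≡ merge a b a≢b c′ → Merged a b c c′
merge-identifies a b a≢b c c′ e with c ≟F a | c′ ≟F a
... | yes p | yes q = same (trans p (sym q))
... | yes p | no q  = ab p (sym (punchOut-injective a≢b (q ∘ sym) e))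
... | no p  | yes q = ba (punchOut-injective (p ∘ sym) a≢b e) q
... | no p  | no q  = same (punchOut-injective (p ∘ sym) (q ∘ sym) e)

module _ {n : ℕ} where

  InImage : ∀ {m} → (Fin m → Fin n) → Fin n → Set
  InImage f x = ∃[ i ] f i ≡ x

  Onto : ∀ {k} → (Fin n → Fin k) → Set
  Onto Π = ∀ j → ∃[ v ] Π v ≡ j

  GluesOnly : ∀ {m k} → (Fin m → Fin n) → (Fin n → Fin k) → Set
  GluesOnly f Π = ∀ x y → Π x ≡ Π y → x ≡ y ⊎ (InImage f x × InImage f y)

  glue-step : ∀ {m k} (f : Fin (suc (suc m)) → Fin n) → Injective _≡_ _≡_ f →
              (Π′ : Fin n → Fin (suc k)) → Onto Π′ → GluesOnly (f ∘ suc) Π′ →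
              Σ (Fin n → Fin k) λ Π → Onto Π × GluesOnly f Π
  glue-step f inj Π′ onto′ glues′ = merge a b a≢b ∘ Π′ , onto , glues
    where
    a = Π′ (f zero)
    b = Π′ (f (suc zero))
    a≢b : a ≢ b
    a≢b e with glues′ _ _ e
    ... | inj₁ e′ with inj e′
    ... | ()
    a≢b e | inj₂ ((i , fi≡f0) , _) with inj fi≡f0
    ... | ()
    onto : Onto (merge a b a≢b ∘ Π′)
    onto j with merge-surjective a b a≢b j
    ... | c , mc≡j with onto′ c
    ... | v , refl = v , mc≡j
    widen : ∀ {x} → InImage (f ∘ suc) x → InImage f x
    widen (i , e) = suc i , e
    inImage : ∀ i x → Π′ x ≡ Π′ (f i) → InImage f x
    inImage i x e with glues′ _ _ e
    ... | inj₁ refl = i , refl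
    ... | inj₂ (p , _) = widen p
    glues : GluesOnly f (merge a b a≢b ∘ Π′)
    glues x y e with merge-identifies a b a≢b _ _ e
    ... | ab p q = inj₂ (inImage zero x p , inImage (suc zero) y q)
    ... | ba p q = inj₂ (inImage (suc zero) x p , inImage zero y q)
    ... | same s with glues′ x y s
    ... | inj₁ x≡y = inj₁ x≡y
    ... | inj₂ (p , q) = inj₂ (widen p , widen q)

  glue-image : ∀ m (f : Fin (suc m) → Fin n) → Injective _≡_ _≡_ f →
               ∃[ k ] (k ≤ n ∸ m × Σ (Fin n → Fin k) λ Π → Onto Π × GluesOnly f Π)
  glue-image zero f inj = n , ≤-refl , (λ x → x) , (λ j → j , refl) , (λ x y e → inj₁ e)
  glue-image (suc m) f inj with glue-image m (f ∘ suc) (suc-injective ∘ inj)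
  ... | zero , _ , Π′ , _ = ⊥-elim (¬Fin0 (Π′ (f zero)))
  ... | suc k , k<n∸m , Π′ , onto′ , glues′ =
    k , subst (k ≤_) (pred[m∸n]≡m∸[1+n] n m) (pred-mono-≤ k<n∸m) ,
    glue-step f inj Π′ onto′ glues′

-- Additivity of distances along a geodesic: for positions a ≤ b ≤ d,
-- (d - a) = (b - a) + (d - b).
∸-split : ∀ a b d → a ≤ b → b ≤ d → d ∸ a ≡ (b ∸ a) + (d ∸ b)
∸-split a b d a≤b b≤d = begin
    d ∸ a             ≡⟨ cong (_∸ a) (sym (m∸n+n≡m b≤d)) ⟩
    (d ∸ b + b) ∸ a   ≡⟨ +-∸-assoc (d ∸ b) a≤b ⟩
    (d ∸ b) + (b ∸ a) ≡⟨ +-comm (d ∸ b) (b ∸ a) ⟩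
    (b ∸ a) + (d ∸ b) ∎
  where open ≡-Reasoning

-- n ∸ (d - 1) ≤ n ∸ d + 1: the class count produced for d = suc m fits the bound.
∸-pred-bound : ∀ n m → n ∸ m ≤ n ∸ suc m + 1
∸-pred-bound zero    zero    = z≤n
∸-pred-bound zero    (suc m) = z≤n
∸-pred-bound (suc n) zero    = ≤-reflexive (+-comm 1 n)
∸-pred-bound (suc n) (suc m) = ∸-pred-bound n m

module Geodesics {n : ℕ} (G : SimpleGraph n) where

  -- The i-th vertex of a walk (the last vertex for i beyond its length).
  vertex : ∀ {x y k} → Walk G x y k → ℕ → Fin n
  vertex {x} _          zero    = x
  vertex {x} here       (suc i) = x
  vertex     (step _ w) (suc i) = vertex w i

  vertex-end : ∀ {x y k} (w : Walk G x y k) → vertex w k ≡ y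
  vertex-end here       = refl
  vertex-end (step _ w) = vertex-end w

  append : ∀ {x y z a b} → Walk G x y a → Walk G y z b → Walk G x z (a + b)
  append here       v = v
  append (step e w) v = step e (append w v)

  take : ∀ {x y k} (w : Walk G x y k) i → i ≤ k → Walk G x (vertex w i) i
  take w          zero    _       = here
  take (step e w) (suc i) (s≤s p) = step e (take w i p)

  drop : ∀ {x y k} (w : Walk G x y k) i → i ≤ k → Walk G (vertex w i) y (k ∸ i)
  drop w          zero    _       = w
  drop (step e w) (suc i) (s≤s p) = drop w i p

  vertex-drop : ∀ {x y k} (w : Walk G x y k) i (p : i ≤ k) t →
                vertex (drop w i p) t ≡ vertex w (i + t)
  vertex-drop w          zero    _       t = refl
  vertex-drop (step e w) (suc i) (s≤s p) t = vertex-drop w i p t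

  -- Prefix and suffix of a shortest walk are shortest: a shorter
  -- replacement would shorten the whole walk.
  geodesic-split : ∀ {x y k} (D : Dist G x y k) i (p : i ≤ k) →
                   Dist G x (vertex (proj₁ D) i) i × Dist G (vertex (proj₁ D) i) y (k ∸ i)
  geodesic-split {k = k} (w , shortest) i p =
      (take w i p , λ m q → +-cancelʳ-≤ (k ∸ i) i m
          (subst (_≤ m + (k ∸ i)) (sym (m+[n∸m]≡n p)) (shortest _ (append q (drop w i p)))))
    , (drop w i p , λ m q → m≤n+o⇒m∸n≤o k i (shortest _ (append (take w i p) q)))

  geodesic-segment : ∀ {x y k} (D : Dist G x y k) i j → i ≤ j → j ≤ k →
                     Dist G (vertex (proj₁ D) i) (vertex (proj₁ D) j) (j ∸ i)
  geodesic-segment D i j i≤j j≤k =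
    subst (λ v → Dist G (vertex (proj₁ D) i) v (j ∸ i))
      (trans (vertex-drop (proj₁ D) i i≤k (j ∸ i)) (cong (vertex (proj₁ D)) (m+[n∸m]≡n i≤j)))
      (proj₁ (geodesic-split (proj₂ (geodesic-split D i i≤k)) (j ∸ i) (∸-monoˡ-≤ i j≤k)))
    where i≤k = ≤-trans i≤j j≤k

  geodesic-distinct : ∀ {x y k} (D : Dist G x y k) i j → i < j → j ≤ k →
                      vertex (proj₁ D) i ≢ vertex (proj₁ D) j
  geodesic-distinct D i j i<j j≤k vi≡vj =
    <-irrefl refl (≤-trans (m<n⇒0<n∸m i<j)
      (proj₂ (geodesic-segment D i j (<⇒≤ i<j) j≤k) 0
        (subst (λ v → Walk G (vertex (proj₁ D) i) v 0) vi≡vj here)))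

  module _ {x y m} (D : Dist G x y (suc m)) where

    d : ℕ
    d = suc m

    v : ℕ → Fin n
    v = vertex (proj₁ D)

    f : Fin d → Fin n
    f i = v (toℕ i)

    i≤d : ∀ (i : Fin d) → toℕ i ≤ d
    i≤d i = <⇒≤ (toℕ<n i)

    f-injective : Injective _≡_ _≡_ f
    f-injective {i} {j} e with <-cmp (toℕ i) (toℕ j)
    ... | tri< i<j _ _ = ⊥-elim (geodesic-distinct D _ _ i<j (i≤d j) e)
    ... | tri≈ _ i≡j _ = toℕ-injective i≡j
    ... | tri> _ _ j<i = ⊥-elim (geodesic-distinct D _ _ j<i (i≤d i) (sym e))

    y∉f : ∀ i → f i ≢ y
    y∉f i e = geodesic-distinct D (toℕ i) d (toℕ<n i) ≤-refl (trans e (sym (vertex-end (proj₁ D))))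

    module _ {k} (Π : Fin n → Fin k) (glues : GluesOnly f Π) where

      alone : ∀ w → Π w ≡ Π y → w ≡ y
      alone w e with glues w y e
      ... | inj₁ w≡y = w≡y
      ... | inj₂ (_ , (i , fi≡y)) = ⊥-elim (y∉f i fi≡y)

      -- Since y is alone in its class, d(v_t, class of y) = d(v_t, y) = d ∸ t.
      dist-to-y : ∀ t → t ≤ d → DistSet G (v t) (Part G Π (Π y)) (d ∸ t)
      dist-to-y t t≤d =
          (y , refl , proj₂ (geodesic-split D t t≤d))
        , λ { w e m′ (walk , _) → subst (λ u → Walk G (v t) u m′ → d ∸ t ≤ m′) (sym (alone w e))
                                    (proj₂ (proj₂ (geodesic-split D t t≤d)) m′) walk }

      resolves : ∀ a b → a ≤ b → b ≤ d →
                 ∃[ p ] ∃[ q ] ∃[ r ] (DistSet G (v a) (Part G Π (Π y)) p × Dist G (v a) (v b) q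
                                      × DistSet G (v b) (Part G Π (Π y)) r × p ≡ q + r)
      resolves a b a≤b b≤d =
        d ∸ a , b ∸ a , d ∸ b , dist-to-y a (≤-trans a≤b b≤d) , geodesic-segment D a b a≤b b≤d ,
        dist-to-y b b≤d , ∸-split a b d a≤b b≤d

      strongly-resolving : ∀ x′ y′ → x′ ≢ y′ → Π x′ ≡ Π y′ →
                           ∃[ j ] (Π x′ ≢ j × StronglyResolves G (Part G Π j) x′ y′)
      strongly-resolving x′ y′ x′≢y′ e with glues x′ y′ e
      ... | inj₁ x′≡y′ = ⊥-elim (x′≢y′ x′≡y′)
      ... | inj₂ ((i , refl) , (j , refl)) = Π y , (λ e′ → y∉f i (alone (f i) e′)) , resolved
        where
        resolved : StronglyResolves G (Part G Π (Π y)) (f i) (f j)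
        resolved with <-cmp (toℕ i) (toℕ j)
        ... | tri< i<j _ _ = inj₁ (resolves (toℕ i) (toℕ j) (<⇒≤ i<j) (i≤d j))
        ... | tri≈ _ i≡j _ = ⊥-elim (x′≢y′ (cong f (toℕ-injective i≡j)))
        ... | tri> _ _ j<i = inj₂ (resolves (toℕ j) (toℕ i) (<⇒≤ j<i) (i≤d i))

    geodesic-partition : StrongPartitionDimension≤ G (n ∸ m)
    geodesic-partition with glue-image m f f-injective
    ... | k , k≤n∸m , Π , onto , glues = k , k≤n∸m , Π , onto , strongly-resolving Π glues

open Geodesics using (geodesic-partition)

-- Diameter 0: the partition into singletons works vacuously.  Diameter
-- suc m: use a diametral geodesic and the bound n ∸ m ≤ n ∸ suc m + 1.
corollary14 : (n d : ℕ) (G : SimpleGraph n) → Connected G → Diameter G d →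
              StrongPartitionDimension≤ G (n ∸ d + 1)
corollary14 n zero G _ _ =
  n , m≤m+n n 1 , (λ x → x) , (λ j → j , refl) , λ x y x≢y e → ⊥-elim (x≢y e)
corollary14 n (suc m) G _ ((_ , _ , D) , _) with geodesic-partition G D
... | k , k≤n∸m , partition = k , ≤-trans k≤n∸m (∸-pred-bound n m) , partition
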